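{- Let $p,q\ge1$ and $r\ge0$ be integers. The sphere $S_r[p,q]=\bigcup_{i+j=r}X_{i,j}$, as a poset under inclusion, has the KLYM property: for every antichain $A\subseteq S_r[p,q]$, $$\sum_{x\in A}\big|P_{h(x)}\big|^{ -1}\le 1,$$ where $P=S_r[p,q]$, $h(x)$ is the height of $x$ in $P$, and $P_h$ is the set of elements of $P$ of height $h$.
   Context: For $0\le i\le p$, $0\le j\le q$, $X_{i,j}$ is the family of subsets of $\{1,\dots,p+q\}$ obtained from $\{1,\dots,p\}$ by removing exactly $i$ elements of $\{1,\dots,p\}$ and adding exactly $j$ elements of $\{p+1,\dots,p+q\}$ (the union defining $S_r[p,q]$ is over $0\le i\le p$, $0\le j\le q$ with $i+j=r$). The height of $x$ in a poset $P$ is the largest $h\ge0$ such that there exist $x_0<x_1<\dots<x_h=x$ in $P$. An antichain is a set of pairwise incomparable elements. -}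

module Defs where

open import Data.Nat as ℕ using (ℕ; zero; suc; _+_; _≤_)
open import Data.Integer using (+_)
open import Data.Rational as ℚ using (ℚ; 0ℚ; _/_)
open import Data.Product using (_×_; Σ; ∃; ∃-syntax; _,_)
open import Data.Vec using (take; drop)
open import Data.Fin.Subset using (Subset; _⊆_; _⊂_; ∁; ∣_∣)
open import Data.List using (List; foldr; length)
open import Data.List.Relation.Unary.Unique.Propositional using (Unique)
import Data.List.Membership.Propositional as LM
open import Relation.Binary.PropositionalEquality using (_≡_)
open import Relation.Nullary using (¬_)
open import Function.Bundles using (_⇔_)

-- Ground set {1,…,p+q} is Fin (p + q); the first p coordinates are {1,…,p},
-- the last q coordinates are {p+1,…,p+q}.  A subset is a Subset (p + q).

X : (p q i j : ℕ) → Subset (p + q) → Set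
X p q i j x = ∣ ∁ (take p x) ∣ ≡ i × ∣ drop p x ∣ ≡ j

InS : (p q r : ℕ) → Subset (p + q) → Set
InS p q r x = ∃[ i ] ∃[ j ] (i ≤ p × j ≤ q × i + j ≡ r × X p q i j x)

data Chain {n : ℕ} (P : Subset n → Set) : ℕ → Subset n → Set where
  start : ∀ {x} → P x → Chain P 0 x
  step  : ∀ {h y x} → Chain P h y → P x → y ⊂ x → Chain P (suc h) x

IsHeight : {n : ℕ} (P : Subset n → Set) → Subset n → ℕ → Set
IsHeight P x h = Chain P h x × (∀ h′ → Chain P h′ x → h′ ≤ h)

LevelSize : {n : ℕ} (P : Subset n → Set) → ℕ → ℕ → Set
LevelSize P h m =
  Σ (List (Subset _)) λ L →
    Unique L × (∀ y → (y LM.∈ L) ⇔ (P y × IsHeight P y h)) × length L ≡ m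

IsAntichain : {n : ℕ} (P : Subset n → Set) → List (Subset n) → Set
IsAntichain P A =
  Unique A × (∀ x → x LM.∈ A → P x) ×
  (∀ x y → x LM.∈ A → y LM.∈ A → ¬ (x ≡ y) → ¬ (x ⊆ y))

-- 1/m as a rational (only applied to m ≥ 1; value at 0 is irrelevant).
inv : ℕ → ℚ
inv zero    = 0ℚ
inv (suc m) = + 1 / suc m

sumℚ : List ℚ → ℚ
sumℚ = foldr ℚ._+_ 0ℚ

-- Centre everything at t = {1,…,p} and give x ∈ X_{i,j} the weight w(x) = (p−i)! i! j! (q−j)!,
-- so that |X_{i,j}| · w(x) = p! q!.  The levels of S_r[p,q] are exactly the X_{i,j}: the height of
-- x ∈ X_{i,j} is j − max(0, r − p).  Hence 1/|P_{h(x)}| = w(x)/(p! q!) and it suffices to show that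
-- every antichain A of S_r[p,q] has total weight at most p! q!.
--
-- This weighted LYM inequality holds for any centre t and any antichain whose members lie at a common
-- distance from t, by induction on the ground set.  If every member of A drops some point of t, then
-- w(x) = ∑ w(x∖e) over the points e ∈ t ∖ x (each term is w(x)/|t ∖ x|); exchanging the sums, the
-- members avoiding e form, after deleting e, an antichain at a common distance from t∖e, of total
-- weight at most (|t|−1)! |∁t|!, and the |t| choices of e give |t|! |∁t|!.  The same works if every
-- member adds a point outside t.  Otherwise some member contains t and another is contained in t, so
-- both equal t and A = {t}.  Read backwards, the same deletion argument shows that the total weight
-- of X_{i,j} is at least p! q!, which is how |P_h| · w(x) ≥ p! q! is obtained without binomials.

module Submission where

open import Defs
open import Data.Bool using (Bool; true; false; not; _∧_; if_then_else_)
open import Data.Bool.Properties using (_≟_; ∧-comm; ∧-idem)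
open import Data.Empty using (⊥-elim)
open import Data.Fin using (Fin; zero; suc; punchIn)
open import Data.Fin.Subset using (Subset; inside; outside; _⊆_; _⊈_; _⊂_; ∁; ∣_∣)
open import Data.Fin.Subset.Properties
  using (⊆-refl; ⊆-trans; ⊆-antisym; s⊆s; out⊆; drop-∷-⊆; out⊂in; s⊂s; ⊂-trans; p⊂q⇒∣p∣<∣q∣)
open import Data.Integer as ℤ using (+≤+)
import Data.Integer.Properties as ℤₚ
open import Data.Integer.Tactic.RingSolver renaming (solve-∀ to ℤ-solve-∀)
open import Data.List using (List; []; _∷_; map; length; foldr)
open import Data.List.Membership.Propositional using (_∈_; find)
open import Data.List.Properties using (map-∘)
open import Data.List.Relation.Unary.All as All using (All; []; _∷_; all?)
open import Data.List.Relation.Unary.All.Properties using (¬All⇒Any¬)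
open import Data.List.Relation.Unary.AllPairs using (AllPairs; []; _∷_)
open import Data.List.Relation.Unary.Any using (here; there)
open import Data.Nat using (ℕ; zero; suc; pred; s≤s⁻¹; _+_; _*_; _∸_; _≤_; _<_; _<?_; z≤n; s≤s; _!; >-nonZero)
open import Data.Nat.ListAction using (sum)
open import Data.Nat.Properties hiding (_≟_)
open import Algebra.Properties.CommutativeSemigroup +-commutativeSemigroup using () renaming (x∙yz≈y∙xz to +-swap)
open import Data.Nat.Tactic.RingSolver using (solve-∀)
open import Data.Product using (∃-syntax; _×_; _,_; proj₁; proj₂)
open import Data.Rational using (1ℚ; toℚᵘ) renaming (_≤_ to _≤ℚ_)
open import Data.Rational.Properties using (toℚᵘ-homo-+; toℚᵘ-fromℚᵘ; toℚᵘ-cancel-≤)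
open import Data.Rational.Unnormalised as ℚᵘ using (ℚᵘ; mkℚᵘ; *≡*; *≤*)
import Data.Rational.Unnormalised.Properties as ℚᵘₚ
open import Data.Sum using (_⊎_; inj₁; inj₂)
open import Data.Vec using (Vec; []; _∷_; lookup; removeAt; insertAt; _[_]≔_; here; replicate; _++_; take; drop)
open import Data.Vec.Properties using (insertAt-lookup; insertAt-punchIn; insertAt-removeAt; removeAt-insertAt)
open import Function using (_∘_)
open import Function.Bundles using (Equivalence)
open import Relation.Binary.PropositionalEquality
  using (_≡_; refl; sym; trans; cong; cong₂; subst; subst₂; ≢-sym; module ≡-Reasoning)
open import Relation.Nullary using (does; yes; no; contradiction)
open import Algebra.Properties.Semiring.Sum +-*-semiring
  using (sum-syntax; sum-cong-≗; sum-remove; sum-replicate-zero; ∑-distrib-+; *-distribʳ-sum; *-distribˡ-sum)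
  renaming (sum to ∑)

[_] : Bool → ℕ
[ b ] = if b then 1 else 0

∑-mono-≤ : ∀ {n} {f g : Fin n → ℕ} → (∀ e → f e ≤ g e) → ∑ f ≤ ∑ g
∑-mono-≤ {zero}  f≤g = z≤n
∑-mono-≤ {suc n} f≤g = +-mono-≤ (f≤g zero) (∑-mono-≤ (f≤g ∘ suc))

∑-if : ∀ {n} (P : Fin n → Bool) k → ∑[ e < n ] (if P e then k else 0) ≡ ∑[ e < n ] [ P e ] * k
∑-if P k = trans (sum-cong-≗ pointwise) (sym (*-distribʳ-sum k (λ e → [ P e ])))
  where
  pointwise : ∀ e → (if P e then k else 0) ≡ [ P e ] * k
  pointwise e with P e
  ... | true  = sym (+-identityʳ k)
  ... | false = refl

∑-if-vanishes : ∀ {n} (P : Fin n → Bool) (g : Fin n → ℕ) →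
  ∑[ e < n ] [ P e ] ≡ 0 → ∑[ e < n ] (if P e then g e else 0) ≡ 0
∑-if-vanishes {zero}  P g none = refl
∑-if-vanishes {suc n} P g none with P zero
... | false = ∑-if-vanishes (P ∘ suc) (g ∘ suc) none

∑-if-≡ : ∀ {n} (P : Fin n → Bool) (g : Fin n → ℕ) {K} → 0 < ∑[ e < n ] [ P e ] →
  (∀ e → ∑[ e < n ] [ P e ] * (if P e then g e else 0) ≡ (if P e then K else 0)) →
  ∑[ e < n ] (if P e then g e else 0) ≡ K
∑-if-≡ {n} P g {K} pos scale = *-cancelˡ-≡ _ K c {{>-nonZero pos}} (begin
  c * ∑[ e < n ] (if P e then g e else 0)   ≡⟨ *-distribˡ-sum c (λ e → if P e then g e else 0) ⟩
  ∑[ e < n ] (c * (if P e then g e else 0)) ≡⟨ sum-cong-≗ scale ⟩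
  ∑[ e < n ] (if P e then K else 0)         ≡⟨ ∑-if P K ⟩
  c * K                                     ∎)
  where
  open ≡-Reasoning
  c = ∑[ e < n ] [ P e ]

∑-if-≤ : ∀ {n} (P : Fin n → Bool) (g : Fin n → ℕ) {K} →
  (∀ e → ∑[ e < n ] [ P e ] * (if P e then g e else 0) ≡ (if P e then K else 0)) →
  ∑[ e < n ] (if P e then g e else 0) ≤ K
∑-if-≤ {n} P g scale with 0 <? ∑[ e < n ] [ P e ]
... | yes pos = ≤-reflexive (∑-if-≡ P g pos scale)
... | no ¬pos = subst (_≤ _) (sym (∑-if-vanishes P g (n≤0⇒n≡0 (≮⇒≥ ¬pos)))) z≤n

sum-∑-comm : ∀ {n} {A : Set} (f : A → Fin n → ℕ) (F : List A) →
  sum (map (λ x → ∑[ e < n ] f x e) F) ≡ ∑[ e < n ] sum (map (λ x → f x e) F)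
sum-∑-comm {n} f []      = sym (sum-replicate-zero n)
sum-∑-comm     f (x ∷ F) = trans (cong (∑ (f x) +_) (sum-∑-comm f F)) (sym (∑-distrib-+ (f x) _))

sum-map-mono-≤ : ∀ {A : Set} {f g : A → ℕ} {F} → All (λ x → f x ≤ g x) F → sum (map f F) ≤ sum (map g F)
sum-map-mono-≤ []          = z≤n
sum-map-mono-≤ (fx≤gx ∷ h) = +-mono-≤ fx≤gx (sum-map-mono-≤ h)

sum-map-const : ∀ {A : Set} {f : A → ℕ} {k F} → All (λ x → f x ≡ k) F → sum (map f F) ≡ length F * k
sum-map-const []          = refl
sum-map-const (fx≡k ∷ h) = cong₂ _+_ fx≡k (sum-map-const h)

∈⇒≤sum : ∀ {A : Set} (f : A → ℕ) {x F} → x ∈ F → f x ≤ sum (map f F)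
∈⇒≤sum f (here refl)  = m≤m+n _ _
∈⇒≤sum f (there x∈F) = ≤-trans (∈⇒≤sum f x∈F) (m≤n+m _ _)

all-positive-or-zero : ∀ {A : Set} (f : A → ℕ) F → All (λ x → 0 < f x) F ⊎ ∃[ x ] x ∈ F × f x ≡ 0
all-positive-or-zero f F with all? (λ x → 0 <? f x) F
... | yes all-pos = inj₁ all-pos
... | no ¬all-pos with find (¬All⇒Any¬ (λ x → 0 <? f x) F ¬all-pos)
...   | x , x∈F , ¬pos = inj₂ (x , x∈F , n≤0⇒n≡0 (≮⇒≥ ¬pos))

-- Counting positions by the pair of values (t e, x e)

isPair : Bool → Bool → Bool → Bool → Bool
isPair a c s y = does (s ≟ a) ∧ does (y ≟ c)

count : ∀ {n} → Bool → Bool → Subset n → Subset n → ℕ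
count {n} a c t x = ∑[ e < n ] [ isPair a c (lookup t e) (lookup x e) ]

count-row : ∀ {n} a (t x : Subset n) → count a inside t x + count a outside t x ≡ count a a t t
count-row a t x = trans
  (sym (∑-distrib-+ (λ e → [ isPair a inside (lookup t e) (lookup x e) ])
                    (λ e → [ isPair a outside (lookup t e) (lookup x e) ])))
  (sum-cong-≗ λ e → row-pointwise a (lookup t e) (lookup x e))
  where
  row-pointwise : ∀ a s y → [ isPair a inside s y ] + [ isPair a outside s y ] ≡ [ isPair a a s s ]
  row-pointwise a s y with s ≟ a
  ... | no  _ = refl
  ... | yes _ with y
  ...   | true  = refl
  ...   | false = refl

count-self : ∀ {n} b (t : Subset n) → count b (not b) t t ≡ 0
count-self {n} b t = trans (sum-cong-≗ λ e → never b (lookup t e)) (sum-replicate-zero n)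
  where
  never : ∀ b s → [ isPair b (not b) s s ] ≡ 0
  never true  true  = refl
  never true  false = refl
  never false true  = refl
  never false false = refl

count-swap : ∀ {n} a c (t x : Subset n) → count a c t x ≡ count c a x t
count-swap a c t x = sum-cong-≗ λ e → cong [_] (∧-comm (does (lookup t e ≟ a)) _)

count-column : ∀ {n} (t y : Subset n) → ∣ y ∣ ≡ count inside inside t y + count outside inside t y
count-column []            []            = refl
count-column (inside  ∷ t) (inside  ∷ y) = cong suc (count-column t y)
count-column (outside ∷ t) (inside  ∷ y) = trans (cong suc (count-column t y)) (sym (+-suc _ _))
count-column (inside  ∷ t) (outside ∷ y) = count-column t y
count-column (outside ∷ t) (outside ∷ y) = count-column t y

lookup-removeAt : ∀ {n} {A : Set} (xs : Vec A (suc n)) i j → lookup (removeAt xs i) j ≡ lookup xs (punchIn i j)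
lookup-removeAt xs i j = begin
  lookup (removeAt xs i) j
    ≡⟨ insertAt-punchIn (removeAt xs i) i (lookup xs i) j ⟨
  lookup (insertAt (removeAt xs i) i (lookup xs i)) (punchIn i j)
    ≡⟨ cong (λ v → lookup v (punchIn i j)) (insertAt-removeAt xs i) ⟩
  lookup xs (punchIn i j) ∎
  where open ≡-Reasoning

count-removeAt : ∀ {n} a c (t x : Subset (suc n)) e {s y} → lookup t e ≡ s → lookup x e ≡ y →
  count a c t x ≡ [ isPair a c s y ] + count a c (removeAt t e) (removeAt x e)
count-removeAt a c t x e refl refl = trans (sum-remove {i = e} λ j → [ isPair a c (lookup t j) (lookup x j) ])
  (cong ([ isPair a c (lookup t e) (lookup x e) ] +_) (sum-cong-≗ λ j →
  sym (cong₂ (λ s y → [ isPair a c s y ]) (lookup-removeAt t e j) (lookup-removeAt x e j))))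

count-insertAt : ∀ {n} a c (t : Subset (suc n)) (x : Subset n) e v →
  count a c t (insertAt x e v) ≡ [ isPair a c (lookup t e) v ] + count a c (removeAt t e) x
count-insertAt a c t x e v = trans (count-removeAt a c t (insertAt x e v) e refl (insertAt-lookup x e v))
  (cong (λ x′ → [ isPair a c (lookup t e) v ] + count a c (removeAt t e) x′) (removeAt-insertAt x e v))

count-clear : ∀ {n} a c (t y : Subset n) e {b} → lookup t e ≡ b → lookup y e ≡ inside →
  [ isPair a c b inside ] + count a c t (y [ e ]≔ outside) ≡ [ isPair a c b outside ] + count a c t y
count-clear a c (s ∷ t) (inside ∷ y) zero refl refl = +-swap [ isPair a c s inside ] [ isPair a c s outside ] (count a c t y)
count-clear a c (s ∷ t) (y₀ ∷ y) (suc e) {b} tₑ yₑ = begin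
  [ isPair a c b inside ] + ([ isPair a c s y₀ ] + count a c t (y [ e ]≔ outside))
    ≡⟨ +-swap [ isPair a c b inside ] [ isPair a c s y₀ ] _ ⟩
  [ isPair a c s y₀ ] + ([ isPair a c b inside ] + count a c t (y [ e ]≔ outside))
    ≡⟨ cong ([ isPair a c s y₀ ] +_) (count-clear a c t y e tₑ yₑ) ⟩
  [ isPair a c s y₀ ] + ([ isPair a c b outside ] + count a c t y)
    ≡⟨ +-swap [ isPair a c s y₀ ] [ isPair a c b outside ] _ ⟩
  [ isPair a c b outside ] + ([ isPair a c s y₀ ] + count a c t y) ∎
  where open ≡-Reasoning

position-of : ∀ {n} a c (t x : Subset n) → 0 < count a c t x → ∃[ e ] lookup t e ≡ a × lookup x e ≡ c
position-of a c (s ∷ t) (y ∷ x) pos with s ≟ a | y ≟ c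
... | yes sₐ | yes y꜀ = zero , sₐ , y꜀
... | yes _  | no  _  = let e , tₑ , xₑ = position-of a c t x pos in suc e , tₑ , xₑ
... | no  _  | _      = let e , tₑ , xₑ = position-of a c t x pos in suc e , tₑ , xₑ

count-zero⇒⊆ : ∀ {n} {x y : Subset n} → count outside inside x y ≡ 0 → y ⊆ x
count-zero⇒⊆ {x = []}         {[]}          _ = ⊆-refl
count-zero⇒⊆ {x = s ∷ x}      {outside ∷ y} h = out⊆ (count-zero⇒⊆ (m+n≡0⇒n≡0 _ h))
count-zero⇒⊆ {x = inside ∷ x} {inside ∷ y}  h = s⊆s (count-zero⇒⊆ h)

clear-⊂ : ∀ {n} {y : Subset n} e → lookup y e ≡ inside → y [ e ]≔ outside ⊂ y
clear-⊂ {y = inside ∷ y} zero    refl = out⊂in ⊆-refl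
clear-⊂ {y = a ∷ y}      (suc e) yₑ   = s⊂s (clear-⊂ e yₑ)

distance : ∀ {n} → Subset n → Subset n → ℕ
distance t x = count inside outside t x + count outside inside t x

distance-self : ∀ {n} (t : Subset n) → distance t t ≡ 0
distance-self t = cong₂ _+_ (count-self inside t) (count-self outside t)

distance-zero : ∀ {n} {t y : Subset n} → distance t y ≡ 0 → y ≡ t
distance-zero {t = t} {y} d≡0 = ⊆-antisym
  (count-zero⇒⊆ (m+n≡0⇒n≡0 _ d≡0))
  (count-zero⇒⊆ (trans (sym (count-swap inside outside t y)) (m+n≡0⇒m≡0 _ d≡0)))

distance-removeAt : ∀ {n} b (t x : Subset (suc n)) e → lookup t e ≡ b → lookup x e ≡ not b →
  distance t x ≡ suc (distance (removeAt t e) (removeAt x e))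
distance-removeAt inside t x e tₑ xₑ =
  cong₂ _+_ (count-removeAt inside outside t x e tₑ xₑ) (count-removeAt outside inside t x e tₑ xₑ)
distance-removeAt outside t x e tₑ xₑ =
  trans (cong₂ _+_ (count-removeAt inside outside t x e tₑ xₑ) (count-removeAt outside inside t x e tₑ xₑ))
        (+-suc _ _)

-- Antichains and their slices along a coordinate

Incomparable : ∀ {n} → Subset n → Subset n → Set
Incomparable x y = x ⊈ y × y ⊈ x

Antichain : ∀ {n} → List (Subset n) → Set
Antichain = AllPairs Incomparable

IsAntichain⇒Antichain : ∀ {n} {P : Subset n → Set} {A} → IsAntichain P A → Antichain A
IsAntichain⇒Antichain {A = []}    _ = []
IsAntichain⇒Antichain {A = x ∷ A} (x∉A ∷ unique , in-P , incomparable) =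
  All.tabulate (λ {y} y∈A → incomparable x y (here refl) (there y∈A) (All.lookup x∉A y∈A)
                          , incomparable y x (there y∈A) (here refl) (≢-sym (All.lookup x∉A y∈A)))
  ∷ IsAntichain⇒Antichain (unique , (λ y → in-P y ∘ there) ,
                           (λ y z y∈A z∈A → incomparable y z (there y∈A) (there z∈A)))

antichain-⊆⇒≡ : ∀ {n} {F : List (Subset n)} {x y} → Antichain F → x ∈ F → y ∈ F → x ⊆ y → x ≡ y
antichain-⊆⇒≡ (_  ∷ _)  (here refl)  (here refl)  _   = refl
antichain-⊆⇒≡ (x# ∷ _)  (here refl)  (there y∈F) x⊆y = ⊥-elim (proj₁ (All.lookup x# y∈F) x⊆y)
antichain-⊆⇒≡ (x# ∷ _)  (there x∈F) (here refl)  x⊆y = ⊥-elim (proj₂ (All.lookup x# x∈F) x⊆y)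
antichain-⊆⇒≡ (_  ∷ ac) (there x∈F) (there y∈F) x⊆y = antichain-⊆⇒≡ ac x∈F y∈F x⊆y

sum-antichain-≡ : ∀ {n} (f : Subset n → ℕ) {y} {F} → Antichain F → All (_≡ y) F → sum (map f F) ≤ f y
sum-antichain-≡ f []       []                = z≤n
sum-antichain-≡ f (_ ∷ _)  (refl ∷ [])       = ≤-reflexive (+-identityʳ _)
sum-antichain-≡ f (x# ∷ _) (refl ∷ refl ∷ _) = ⊥-elim (proj₁ (All.head x#) ⊆-refl)

⊆-∷ : ∀ {m n} {a b} {p q : Subset m} {p′ q′ : Subset n} →
  a ∷ p ⊆ b ∷ q → p′ ⊆ q′ → a ∷ p′ ⊆ b ∷ q′
⊆-∷ {a = outside} _     p′⊆q′ = out⊆ p′⊆q′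
⊆-∷ {a = inside}  ap⊆bq p′⊆q′ with ap⊆bq here
... | here = s⊆s p′⊆q′

⊆-removeAt⁻ : ∀ {n} {x y : Subset (suc n)} e → lookup x e ≡ lookup y e → removeAt x e ⊆ removeAt y e → x ⊆ y
⊆-removeAt⁻ {x = a ∷ x} {b ∷ y} zero refl x⊆y = s⊆s x⊆y
⊆-removeAt⁻ {x = a ∷ x@(_ ∷ _)} {b ∷ y@(_ ∷ _)} (suc e) xₑ≡yₑ ax⊆by =
  ⊆-∷ ax⊆by (⊆-removeAt⁻ e xₑ≡yₑ (drop-∷-⊆ ax⊆by))

removeAt-incomparable : ∀ {n} {x y : Subset (suc n)} e → lookup x e ≡ lookup y e →
  Incomparable x y → Incomparable (removeAt x e) (removeAt y e)
removeAt-incomparable e xₑ≡yₑ (x⊈y , y⊈x) =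
  x⊈y ∘ ⊆-removeAt⁻ e xₑ≡yₑ , y⊈x ∘ ⊆-removeAt⁻ e (sym xₑ≡yₑ)

slice : ∀ {n} → Bool → Fin (suc n) → List (Subset (suc n)) → List (Subset n)
slice v e []      = []
slice v e (x ∷ F) with lookup x e ≟ v
... | yes _ = removeAt x e ∷ slice v e F
... | no  _ = slice v e F

slice⁺ : ∀ {n} {P : Subset (suc n) → Set} {Q : Subset n → Set} v e {F} →
  (∀ {x} → lookup x e ≡ v → P x → Q (removeAt x e)) → All P F → All Q (slice v e F)
slice⁺ v e         f []        = []
slice⁺ v e {x ∷ F} f (px ∷ pF) with lookup x e ≟ v
... | yes xₑ = f xₑ px ∷ slice⁺ v e f pF
... | no  _  = slice⁺ v e f pF

slice-antichain : ∀ {n} v e {F : List (Subset (suc n))} → Antichain F → Antichain (slice v e F)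
slice-antichain v e         []        = []
slice-antichain v e {x ∷ F} (x# ∷ ac) with lookup x e ≟ v
... | yes xₑ = slice⁺ v e (λ yₑ → removeAt-incomparable e (trans xₑ (sym yₑ))) x# ∷ slice-antichain v e ac
... | no  _  = slice-antichain v e ac

∈-slice : ∀ {n} {v e} {F : List (Subset (suc n))} {x} → x ∈ F → lookup x e ≡ v → removeAt x e ∈ slice v e F
∈-slice {v = v} {e} {y ∷ F} (here refl) xₑ with lookup y e ≟ v
... | yes _  = here refl
... | no ¬xₑ = contradiction xₑ ¬xₑ
∈-slice {v = v} {e} {y ∷ F} (there x∈F) xₑ with lookup y e ≟ v
... | yes _ = there (∈-slice x∈F xₑ)
... | no  _ = ∈-slice x∈F xₑ

sum-slice : ∀ {n} c v e (g : Subset n → ℕ) F →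
  sum (map (λ x → if c ∧ does (lookup x e ≟ v) then g (removeAt x e) else 0) F) ≡
  (if c then sum (map g (slice v e F)) else 0)
sum-slice false v e g []      = refl
sum-slice false v e g (x ∷ F) = sum-slice false v e g F
sum-slice true  v e g []      = refl
sum-slice true  v e g (x ∷ F) with lookup x e ≟ v
... | yes _ = cong (g (removeAt x e) +_) (sum-slice true v e g F)
... | no  _ = sum-slice true v e g F

-- Weights

weight : ∀ {n} → Subset n → Subset n → ℕ
weight t x =
  count inside inside t x ! * count inside outside t x ! * count outside inside t x ! * count outside outside t x !

totalWeight : ∀ {n} → Subset n → ℕ
totalWeight t = count inside inside t t ! * count outside outside t t !

totalWeight-positive : ∀ {n} (t : Subset n) → 0 < totalWeight t
totalWeight-positive t = *-mono-≤ (1≤n! (count inside inside t t)) (1≤n! (count outside outside t t))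

weight-self : ∀ {n} (t : Subset n) → weight t t ≡ totalWeight t
weight-self t rewrite count-self inside t | count-self outside t =
  cong (_* count outside outside t t !)
       (trans (*-identityʳ (count inside inside t t ! * 1)) (*-identityʳ (count inside inside t t !)))

weight-removeAt : ∀ {n} b (t x : Subset (suc n)) e → lookup t e ≡ b → lookup x e ≡ not b →
  weight t x ≡ count b (not b) t x * weight (removeAt t e) (removeAt x e)
weight-removeAt inside t x e tₑ xₑ
  rewrite count-removeAt inside  inside  t x e tₑ xₑ | count-removeAt inside  outside t x e tₑ xₑ
        | count-removeAt outside inside  t x e tₑ xₑ | count-removeAt outside outside t x e tₑ xₑ
  = factor (c inside inside !) (c inside outside) (c inside outside !) (c outside inside !) (c outside outside !)
  where
  c : Bool → Bool → ℕ
  c a a′ = count a a′ (removeAt t e) (removeAt x e)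
  factor : ∀ a k k! b d → a * (k! + k * k!) * b * d ≡ (1 + k) * (a * k! * b * d)
  factor = solve-∀
weight-removeAt outside t x e tₑ xₑ
  rewrite count-removeAt inside  inside  t x e tₑ xₑ | count-removeAt inside  outside t x e tₑ xₑ
        | count-removeAt outside inside  t x e tₑ xₑ | count-removeAt outside outside t x e tₑ xₑ
  = factor (c inside inside !) (c inside outside !) (c outside inside) (c outside inside !) (c outside outside !)
  where
  c : Bool → Bool → ℕ
  c a a′ = count a a′ (removeAt t e) (removeAt x e)
  factor : ∀ a b k k! d → a * b * (k! + k * k!) * d ≡ (1 + k) * (a * b * k! * d)
  factor = solve-∀

totalWeight-removeAt : ∀ {n} b (t : Subset (suc n)) e → lookup t e ≡ b →
  totalWeight t ≡ count b b t t * totalWeight (removeAt t e)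
totalWeight-removeAt inside t e tₑ
  rewrite count-removeAt inside inside t t e tₑ tₑ | count-removeAt outside outside t t e tₑ tₑ
  = *-assoc (suc (c inside)) (c inside !) (c outside !)
  where
  c : Bool → ℕ
  c a = count a a (removeAt t e) (removeAt t e)
totalWeight-removeAt outside t e tₑ
  rewrite count-removeAt inside inside t t e tₑ tₑ | count-removeAt outside outside t t e tₑ tₑ
  = factor (c inside !) (c outside) (c outside !)
  where
  c : Bool → ℕ
  c a = count a a (removeAt t e) (removeAt t e)
  factor : ∀ a k k! → a * (k! + k * k!) ≡ (1 + k) * (a * k!)
  factor = solve-∀

share : ∀ {n} → Bool → Subset (suc n) → Subset (suc n) → Fin (suc n) → ℕ
share b t x e = if isPair b (not b) (lookup t e) (lookup x e) then weight (removeAt t e) (removeAt x e) else 0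

share-scaled : ∀ {n} b (t x : Subset (suc n)) e →
  count b (not b) t x * share b t x e ≡ (if isPair b (not b) (lookup t e) (lookup x e) then weight t x else 0)
share-scaled b t x e with lookup t e ≟ b | lookup x e ≟ not b
... | yes tₑ | yes xₑ = sym (weight-removeAt b t x e tₑ xₑ)
... | yes _  | no  _  = *-zeroʳ (count b (not b) t x)
... | no  _  | _      = *-zeroʳ (count b (not b) t x)

totalShare-scaled : ∀ {n} b (t : Subset (suc n)) e →
  count b b t t * (if isPair b b (lookup t e) (lookup t e) then totalWeight (removeAt t e) else 0) ≡
  (if isPair b b (lookup t e) (lookup t e) then totalWeight t else 0)
totalShare-scaled b t e with lookup t e ≟ b
... | yes tₑ = sym (totalWeight-removeAt b t e tₑ)
... | no  _  = *-zeroʳ (count b b t t)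

sum-shares : ∀ {n} b (t : Subset (suc n)) F →
  sum (map (λ x → ∑[ e < suc n ] share b t x e) F) ≡
  ∑[ e < suc n ] (if isPair b b (lookup t e) (lookup t e) then sum (map (weight (removeAt t e)) (slice (not b) e F)) else 0)
sum-shares b t F = trans (sum-∑-comm (share b t) F) (sum-cong-≗ λ e →
  trans (sum-slice (does (lookup t e ≟ b)) (not b) e (weight (removeAt t e)) F)
        (cong (λ c → if c then sum (map (weight (removeAt t e)) (slice (not b) e F)) else 0)
              (sym (∧-idem (does (lookup t e ≟ b))))))

weight-split-≤ : ∀ {n} b (t x : Subset (suc n)) → ∑[ e < suc n ] share b t x e ≤ weight t x
weight-split-≤ b t x = ∑-if-≤ _ (λ e → weight (removeAt t e) (removeAt x e)) (share-scaled b t x)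

weight-split-≡ : ∀ {n} b (t x : Subset (suc n)) → 0 < count b (not b) t x → ∑[ e < suc n ] share b t x e ≡ weight t x
weight-split-≡ b t x pos = ∑-if-≡ _ (λ e → weight (removeAt t e) (removeAt x e)) pos (share-scaled b t x)

-- The weighted LYM inequality

WeightedLYM : ℕ → Set
WeightedLYM n = ∀ (t : Subset n) d F → Antichain F → All (λ x → distance t x ≡ d) F →
  sum (map (weight t) F) ≤ totalWeight t

deletion-upper : ∀ {n} b → WeightedLYM n → ∀ (t : Subset (suc n)) d F →
  Antichain F → All (λ x → distance t x ≡ d) F → All (λ x → 0 < count b (not b) t x) F →
  sum (map (weight t) F) ≤ totalWeight t
deletion-upper {n} b lym t d F ac dist pos = begin
  sum (map (weight t) F)
    ≤⟨ sum-map-mono-≤ (All.map (λ {x} p → ≤-reflexive (sym (weight-split-≡ b t x p))) pos) ⟩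
  sum (map (λ x → ∑[ e < suc n ] share b t x e) F)
    ≡⟨ sum-shares b t F ⟩
  ∑[ e < suc n ] (if P e then sum (map (weight (removeAt t e)) (slice (not b) e F)) else 0)
    ≤⟨ ∑-mono-≤ slice-bound ⟩
  ∑[ e < suc n ] (if P e then totalWeight (removeAt t e) else 0)
    ≤⟨ ∑-if-≤ P (λ e → totalWeight (removeAt t e)) (totalShare-scaled b t) ⟩
  totalWeight t ∎
  where
  open ≤-Reasoning
  P : Fin (suc n) → Bool
  P e = isPair b b (lookup t e) (lookup t e)
  slice-bound : ∀ e → (if P e then sum (map (weight (removeAt t e)) (slice (not b) e F)) else 0) ≤
                       (if P e then totalWeight (removeAt t e) else 0)
  slice-bound e with lookup t e ≟ b
  ... | no  _  = z≤n
  ... | yes tₑ = lym (removeAt t e) (pred d) (slice (not b) e F) (slice-antichain (not b) e ac)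
    (slice⁺ (not b) e (λ {x} xₑ dx → cong pred (trans (sym (distance-removeAt b t x e tₑ xₑ)) dx)) dist)

centred-bound : ∀ {n} (t : Subset n) d {F x₁ x₂} → Antichain F → All (λ x → distance t x ≡ d) F →
  x₁ ∈ F → count inside outside t x₁ ≡ 0 → x₂ ∈ F → count outside inside t x₂ ≡ 0 →
  sum (map (weight t) F) ≤ totalWeight t
centred-bound t d {F} {x₁} {x₂} ac dist x₁∈F x₁-keeps x₂∈F x₂-adds = begin
  sum (map (weight t) F) ≤⟨ sum-antichain-≡ (weight t) {t} ac (All.map (λ dy → distance-zero (trans dy d≡0)) dist) ⟩
  weight t t             ≡⟨ weight-self t ⟩
  totalWeight t          ∎
  where
  open ≤-Reasoning
  t⊆x₁ : t ⊆ x₁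
  t⊆x₁ = count-zero⇒⊆ (trans (sym (count-swap inside outside t x₁)) x₁-keeps)
  x₂⊆t : x₂ ⊆ t
  x₂⊆t = count-zero⇒⊆ x₂-adds
  x₁≡t : x₁ ≡ t
  x₁≡t = ⊆-antisym (subst (_⊆ t) (antichain-⊆⇒≡ ac x₂∈F x₁∈F (⊆-trans x₂⊆t t⊆x₁)) x₂⊆t) t⊆x₁
  d≡0 : d ≡ 0
  d≡0 = trans (sym (All.lookup dist (subst (_∈ F) x₁≡t x₁∈F))) (distance-self t)

weighted-LYM : ∀ n → WeightedLYM n
weighted-LYM zero    [] d []       ac dist = z≤n
weighted-LYM zero    [] d ([] ∷ F) ac dist = centred-bound [] d ac dist (here refl) refl (here refl) refl
weighted-LYM (suc n) t  d F        ac dist with all-positive-or-zero (count inside outside t) F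
... | inj₁ all-remove = deletion-upper inside (weighted-LYM n) t d F ac dist all-remove
... | inj₂ (x₁ , x₁∈F , x₁-keeps) with all-positive-or-zero (count outside inside t) F
...   | inj₁ all-add = deletion-upper outside (weighted-LYM n) t d F ac dist all-add
...   | inj₂ (x₂ , x₂∈F , x₂-adds) = centred-bound t d ac dist x₁∈F x₁-keeps x₂∈F x₂-adds

-- Total weight of a level

Covers : ∀ {n} → Subset n → ℕ → ℕ → List (Subset n) → Set
Covers t i j L = ∀ z → count inside outside t z ≡ i → count outside inside t z ≡ j → z ∈ L

slice-covers : ∀ {n} b (t : Subset (suc n)) {e L i j} → lookup t e ≡ b →
  Covers t ([ isPair inside outside b (not b) ] + i) ([ isPair outside inside b (not b) ] + j) L →
  Covers (removeAt t e) i j (slice (not b) e L)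
slice-covers b t {e} {L} tₑ cover z′ z′-removes z′-adds =
  subst (_∈ slice (not b) e L) (removeAt-insertAt z′ e (not b))
    (∈-slice (cover z (count-z inside outside z′-removes) (count-z outside inside z′-adds)) (insertAt-lookup z′ e (not b)))
  where
  z = insertAt z′ e (not b)
  count-z : ∀ a c {k} → count a c (removeAt t e) z′ ≡ k → count a c t z ≡ [ isPair a c b (not b) ] + k
  count-z a c refl = trans (count-insertAt a c t z′ e (not b)) (cong (λ s → [ isPair a c s (not b) ] + _) tₑ)

deletion-lower : ∀ {n} b (t : Subset (suc n)) L → 0 < count b b t t →
  (∀ e → lookup t e ≡ b → totalWeight (removeAt t e) ≤ sum (map (weight (removeAt t e)) (slice (not b) e L))) →
  totalWeight t ≤ sum (map (weight t) L)
deletion-lower {n} b t L pos bound = begin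
  totalWeight t
    ≡⟨ ∑-if-≡ P (λ e → totalWeight (removeAt t e)) pos (totalShare-scaled b t) ⟨
  ∑[ e < suc n ] (if P e then totalWeight (removeAt t e) else 0)
    ≤⟨ ∑-mono-≤ slice-bound ⟩
  ∑[ e < suc n ] (if P e then sum (map (weight (removeAt t e)) (slice (not b) e L)) else 0)
    ≡⟨ sum-shares b t L ⟨
  sum (map (λ x → ∑[ e < suc n ] share b t x e) L)
    ≤⟨ sum-map-mono-≤ {F = L} (All.tabulate λ {x} _ → weight-split-≤ b t x) ⟩
  sum (map (weight t) L) ∎
  where
  open ≤-Reasoning
  P : Fin (suc n) → Bool
  P e = isPair b b (lookup t e) (lookup t e)
  slice-bound : ∀ e → (if P e then totalWeight (removeAt t e) else 0) ≤
                       (if P e then sum (map (weight (removeAt t e)) (slice (not b) e L)) else 0)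
  slice-bound e with lookup t e ≟ b
  ... | no  _  = z≤n
  ... | yes tₑ = bound e tₑ

totalWeight≤sum-covering : ∀ {n} (t : Subset n) L i j →
  i ≤ count inside inside t t → j ≤ count outside outside t t → Covers t i j L →
  totalWeight t ≤ sum (map (weight t) L)
totalWeight≤sum-covering t L zero zero _ _ cover = subst (_≤ sum (map (weight t) L)) (weight-self t)
  (∈⇒≤sum (weight t) (cover t (count-self inside t) (count-self outside t)))
totalWeight≤sum-covering {zero} [] L (suc i) j    () _  _
totalWeight≤sum-covering {zero} [] L zero (suc j) _  () _
totalWeight≤sum-covering {suc n} t L (suc i) j i≤ j≤ cover =
  deletion-lower inside t L (≤-trans (s≤s z≤n) i≤) λ e tₑ →
    totalWeight≤sum-covering (removeAt t e) (slice outside e L) i j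
      (s≤s⁻¹ (subst (suc i ≤_) (count-removeAt inside inside t t e tₑ tₑ) i≤))
      (subst (j ≤_) (count-removeAt outside outside t t e tₑ tₑ) j≤)
      (slice-covers inside t tₑ cover)
totalWeight≤sum-covering {suc n} t L zero (suc j) _ j≤ cover =
  deletion-lower outside t L (≤-trans (s≤s z≤n) j≤) λ e tₑ →
    totalWeight≤sum-covering (removeAt t e) (slice inside e L) zero j z≤n
      (s≤s⁻¹ (subst (suc j ≤_) (count-removeAt outside outside t t e tₑ tₑ) j≤))
      (slice-covers outside t tₑ cover)

-- Heights in the sphere S_r[p,q]

cancel-summandʳ : ∀ {a b a′ b′ c} → a + b ≡ c → a′ + b′ ≡ c → b ≡ b′ → a ≡ a′
cancel-summandʳ {b = b} eq eq′ refl = +-cancelʳ-≡ b _ _ (trans eq (sym eq′))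

cancel-summandˡ : ∀ {a b a′ b′ c} → a + b ≡ c → a′ + b′ ≡ c → a ≡ a′ → b ≡ b′
cancel-summandˡ {a = a} eq eq′ refl = +-cancelˡ-≡ a _ _ (trans eq (sym eq′))

chain-top : ∀ {n} {P : Subset n → Set} {h y} → Chain P h y → P y
chain-top (start y∈P)    = y∈P
chain-top (step _ y∈P _) = y∈P

height-unique : ∀ {n} {P : Subset n → Set} {y h₁ h₂} → IsHeight P y h₁ → IsHeight P y h₂ → h₁ ≡ h₂
height-unique (chain₁ , max₁) (chain₂ , max₂) = ≤-antisym (max₂ _ chain₁) (max₁ _ chain₂)

centre : ∀ p q → Subset (p + q)
centre p q = replicate p inside ++ replicate q outside

removed-centre : ∀ p q (x : Subset (p + q)) → count inside outside (centre p q) x ≡ ∣ ∁ (take p x) ∣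
removed-centre zero    zero    []            = refl
removed-centre zero    (suc q) (a ∷ x)       = removed-centre zero q x
removed-centre (suc p) q       (inside  ∷ x) = removed-centre p q x
removed-centre (suc p) q       (outside ∷ x) = cong suc (removed-centre p q x)

added-centre : ∀ p q (x : Subset (p + q)) → count outside inside (centre p q) x ≡ ∣ drop p x ∣
added-centre zero    zero    []            = refl
added-centre zero    (suc q) (inside  ∷ x) = cong suc (added-centre zero q x)
added-centre zero    (suc q) (outside ∷ x) = added-centre zero q x
added-centre (suc p) q       (a ∷ x)       = added-centre p q x

kept-centre : ∀ p q → count inside inside (centre p q) (centre p q) ≡ p
kept-centre zero    zero    = refl
kept-centre zero    (suc q) = kept-centre zero q
kept-centre (suc p) q       = cong suc (kept-centre p q)

spare-centre : ∀ p q → count outside outside (centre p q) (centre p q) ≡ q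
spare-centre zero    zero    = refl
spare-centre zero    (suc q) = cong suc (spare-centre zero q)
spare-centre (suc p) q       = spare-centre p q

module Sphere (p q r : ℕ) where

  -- For x ∈ X_{i,j}: removed x = i, added x = j, kept x = p − i and omitted x = q − j.

  S : Subset (p + q) → Set
  S = InS p q r

  kept removed added omitted : Subset (p + q) → ℕ
  kept    = count inside  inside  (centre p q)
  removed = count inside  outside (centre p q)
  added   = count outside inside  (centre p q)
  omitted = count outside outside (centre p q)

  kept+removed : ∀ x → kept x + removed x ≡ p
  kept+removed x = trans (count-row inside (centre p q) x) (kept-centre p q)

  added+omitted : ∀ x → added x + omitted x ≡ q
  added+omitted x = trans (count-row outside (centre p q) x) (spare-centre p q)

  removed≤p : ∀ x → removed x ≤ p
  removed≤p x = subst (removed x ≤_) (kept+removed x) (m≤n+m _ _)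

  added≤q : ∀ x → added x ≤ q
  added≤q x = subst (added x ≤_) (added+omitted x) (m≤m+n _ _)

  S⇒ : ∀ {x} → S x → removed x + added x ≡ r
  S⇒ {x} (_ , _ , _ , _ , i+j≡r , removed≡i , added≡j) =
    trans (cong₂ _+_ (trans (removed-centre p q x) removed≡i) (trans (added-centre p q x) added≡j)) i+j≡r

  ⇒S : ∀ {x} → removed x + added x ≡ r → S x
  ⇒S {x} on-sphere = removed x , added x , removed≤p x , added≤q x , on-sphere ,
                     sym (removed-centre p q x) , sym (added-centre p q x)

  r∸p≤added : ∀ {y} → S y → r ∸ p ≤ added y
  r∸p≤added {y} y∈S = begin
    r ∸ p                          ≤⟨ ∸-monoʳ-≤ r (removed≤p y) ⟩
    r ∸ removed y                  ≡⟨ cong (_∸ removed y) (S⇒ y∈S) ⟨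
    removed y + added y ∸ removed y ≡⟨ m+n∸m≡n (removed y) (added y) ⟩
    added y                        ∎
    where open ≤-Reasoning

  size-on-S : ∀ {y} → S y → ∣ y ∣ + r ≡ p + 2 * added y
  size-on-S {y} y∈S = begin
    ∣ y ∣ + r                                  ≡⟨ cong₂ _+_ (count-column (centre p q) y) (sym (S⇒ y∈S)) ⟩
    (kept y + added y) + (removed y + added y) ≡⟨ regroup (kept y) (added y) (removed y) ⟩
    (kept y + removed y) + 2 * added y         ≡⟨ cong (_+ 2 * added y) (kept+removed y) ⟩
    p + 2 * added y                            ∎
    where
    open ≡-Reasoning
    regroup : ∀ k a d → (k + a) + (d + a) ≡ (k + d) + 2 * a
    regroup = solve-∀

  added-<-⊂ : ∀ {y′ y} → S y′ → S y → y′ ⊂ y → added y′ < added y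
  added-<-⊂ y′∈S y∈S y′⊂y = *-cancelˡ-< 2 _ _ (+-cancelˡ-< p _ _
    (subst₂ _<_ (size-on-S y′∈S) (size-on-S y∈S) (+-monoˡ-< r (p⊂q⇒∣p∣<∣q∣ y′⊂y))))

  chain-bound : ∀ {h y} → Chain S h y → h + (r ∸ p) ≤ added y
  chain-bound (start y∈S)           = r∸p≤added y∈S
  chain-bound (step chain y∈S y′⊂y) = ≤-trans (s≤s (chain-bound chain)) (added-<-⊂ (chain-top chain) y∈S y′⊂y)

  kept-positive : ∀ {y} → S y → r ∸ p < added y → 0 < kept y
  kept-positive {y} y∈S r∸p<added with kept y in kept≡
  ... | suc _ = s≤s z≤n
  ... | zero  = ⊥-elim (<-irrefl r∸p≡added r∸p<added)
    where
    removed≡p : removed y ≡ p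
    removed≡p = trans (cong (_+ removed y) (sym kept≡)) (kept+removed y)
    r∸p≡added : r ∸ p ≡ added y
    r∸p≡added = trans (cong₂ _∸_ (sym (S⇒ y∈S)) (sym removed≡p)) (m+n∸m≡n (removed y) (added y))

  -- Drop one added element and one kept element: this stays on the sphere and lowers added by one.
  descend : ∀ {y} → S y → r ∸ p < added y → ∃[ y′ ] S y′ × y′ ⊂ y × suc (added y′) ≡ added y
  descend {y} y∈S r∸p<added
    with position-of outside inside (centre p q) y (≤-trans (s≤s z≤n) r∸p<added)
  ... | e₁ , c₁ , yₑ₁
    with position-of inside inside (centre p q) (y [ e₁ ]≔ outside)
           (subst (0 <_) (sym (count-clear inside inside (centre p q) y e₁ c₁ yₑ₁)) (kept-positive y∈S r∸p<added))
  ... | e₂ , c₂ , y₁ₑ₂ =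
    y₂ , ⇒S on-S , ⊂-trans (clear-⊂ e₂ y₁ₑ₂) (clear-⊂ e₁ yₑ₁) , trans (cong suc added₂) added₁
    where
    y₁ = y [ e₁ ]≔ outside
    y₂ = y₁ [ e₂ ]≔ outside
    added₁ : suc (added y₁) ≡ added y
    added₁ = count-clear outside inside (centre p q) y e₁ c₁ yₑ₁
    removed₁ : removed y₁ ≡ removed y
    removed₁ = count-clear inside outside (centre p q) y e₁ c₁ yₑ₁
    added₂ : added y₂ ≡ added y₁
    added₂ = count-clear outside inside (centre p q) y₁ e₂ c₂ y₁ₑ₂
    removed₂ : removed y₂ ≡ suc (removed y₁)
    removed₂ = count-clear inside outside (centre p q) y₁ e₂ c₂ y₁ₑ₂
    on-S : removed y₂ + added y₂ ≡ r
    on-S = begin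
      removed y₂ + added y₂       ≡⟨ cong₂ _+_ removed₂ added₂ ⟩
      suc (removed y₁) + added y₁ ≡⟨ +-suc (removed y₁) (added y₁) ⟨
      removed y₁ + suc (added y₁) ≡⟨ cong₂ _+_ removed₁ added₁ ⟩
      removed y + added y         ≡⟨ S⇒ y∈S ⟩
      r                           ∎
      where open ≡-Reasoning

  chain-exists : ∀ d {y} → S y → added y ≡ d + (r ∸ p) → Chain S d y
  chain-exists zero    y∈S _ = start y∈S
  chain-exists (suc d) y∈S added≡ with descend y∈S (subst (r ∸ p <_) (sym added≡) (s≤s (m≤n+m _ d)))
  ... | y′ , y′∈S , y′⊂y , added′ =
    step (chain-exists d y′∈S (suc-injective (trans added′ added≡))) y∈S y′⊂y

  height : ∀ {y} → S y → IsHeight S y (added y ∸ (r ∸ p))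
  height y∈S = chain-exists _ y∈S (sym (m∸n+n≡m (r∸p≤added y∈S))) ,
               λ h chain → m+n≤o⇒m≤o∸n h (chain-bound chain)

  added-of-height : ∀ {y h} → S y → IsHeight S y h → added y ≡ h + (r ∸ p)
  added-of-height y∈S h-is-height =
    trans (sym (m∸n+n≡m (r∸p≤added y∈S))) (cong (_+ (r ∸ p)) (height-unique (height y∈S) h-is-height))

  weight-by-added : ∀ {x y} → S x → S y → added x ≡ added y → weight (centre p q) x ≡ weight (centre p q) y
  weight-by-added {x} {y} x∈S y∈S added≡ =
    cong₂ _*_ (cong₂ _*_ (cong₂ _*_ (cong _! kept≡) (cong _! removed≡)) (cong _! added≡)) (cong _! omitted≡)
    where
    removed≡ : removed x ≡ removed y
    removed≡ = cancel-summandʳ (S⇒ x∈S) (S⇒ y∈S) added≡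
    kept≡ : kept x ≡ kept y
    kept≡ = cancel-summandʳ (kept+removed x) (kept+removed y) removed≡
    omitted≡ : omitted x ≡ omitted y
    omitted≡ = cancel-summandˡ (added+omitted x) (added+omitted y) added≡

  level-bound : ∀ {x h N} → S x → IsHeight S x h → LevelSize S h N →
    totalWeight (centre p q) ≤ N * weight (centre p q) x
  level-bound {x} {h} {N} x∈S x-height (L , _ , L≡level , ∣L∣≡N) = begin
    totalWeight (centre p q)
      ≤⟨ totalWeight≤sum-covering (centre p q) L (removed x) (added x)
           (subst (removed x ≤_) (sym (kept-centre p q)) (removed≤p x))
           (subst (added x ≤_) (sym (spare-centre p q)) (added≤q x)) covers ⟩
    sum (map (weight (centre p q)) L)
      ≡⟨ sum-map-const (All.tabulate λ {y} y∈L → same-weight (Equivalence.to (L≡level y) y∈L)) ⟩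
    length L * weight (centre p q) x
      ≡⟨ cong (_* weight (centre p q) x) ∣L∣≡N ⟩
    N * weight (centre p q) x ∎
    where
    open ≤-Reasoning
    covers : Covers (centre p q) (removed x) (added x) L
    covers z removed≡ added≡ = Equivalence.from (L≡level z) (z∈S ,
      subst (IsHeight S z) (trans (cong (_∸ (r ∸ p)) added≡) (height-unique (height x∈S) x-height)) (height z∈S))
      where
      z∈S : S z
      z∈S = ⇒S (trans (cong₂ _+_ removed≡ added≡) (S⇒ x∈S))
    same-weight : ∀ {y} → S y × IsHeight S y h → weight (centre p q) y ≡ weight (centre p q) x
    same-weight (y∈S , y-height) =
      weight-by-added y∈S x∈S (trans (added-of-height y∈S y-height) (sym (added-of-height x∈S x-height)))

sumᵘ : List ℚᵘ → ℚᵘ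
sumᵘ = foldr ℚᵘ._+_ ℚᵘ.0ℚᵘ

toℚᵘ-sumℚ : ∀ l → toℚᵘ (sumℚ l) ℚᵘ.≃ sumᵘ (map toℚᵘ l)
toℚᵘ-sumℚ []      = ℚᵘₚ.≃-refl
toℚᵘ-sumℚ (a ∷ l) = ℚᵘₚ.≃-trans (toℚᵘ-homo-+ a (sumℚ l)) (ℚᵘₚ.+-congʳ (toℚᵘ a) (toℚᵘ-sumℚ l))

module _ (k : ℕ) where

  over : ℕ → ℚᵘ
  over w = mkℚᵘ (ℤ.+ w) k

  over-+ : ∀ a b → over a ℚᵘ.+ over b ℚᵘ.≃ over (a + b)
  over-+ a b = *≡* (trans (regroup (ℤ.+ a) (ℤ.+ b) (ℤ.+ suc k))
                          (cong (ℤ._* (ℤ.+ suc k ℤ.* ℤ.+ suc k)) (sym (ℤₚ.pos-+ a b))))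
    where
    regroup : ∀ x y z → (x ℤ.* z ℤ.+ y ℤ.* z) ℤ.* z ≡ (x ℤ.+ y) ℤ.* (z ℤ.* z)
    regroup = ℤ-solve-∀

  inv≤over : ∀ m w → suc k ≤ m * w → toℚᵘ (inv m) ℚᵘ.≤ over w
  inv≤over (suc m) w 1+k≤mw = ℚᵘₚ.≤-respˡ-≃ (ℚᵘₚ.≃-sym (toℚᵘ-fromℚᵘ (mkℚᵘ (ℤ.+ 1) m)))
    (*≤* (subst₂ ℤ._≤_ (sym (ℤₚ.*-identityˡ (ℤ.+ suc k))) (ℤₚ.pos-* w (suc m))
           (+≤+ (subst (suc k ≤_) (*-comm (suc m) w) 1+k≤mw))))

  sum-inv≤over : ∀ {A : Set} (f w : A → ℕ) {F} → All (λ x → suc k ≤ f x * w x) F →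
    sumᵘ (map (λ x → toℚᵘ (inv (f x))) F) ℚᵘ.≤ over (sum (map w F))
  sum-inv≤over f w []                   = *≤* (+≤+ z≤n)
  sum-inv≤over f w {x ∷ F} (bound ∷ bounds) = ℚᵘₚ.≤-respʳ-≃ (over-+ (w x) (sum (map w F)))
    (ℚᵘₚ.+-mono-≤ (inv≤over (f x) (w x) bound) (sum-inv≤over f w bounds))

  over≤1 : ∀ {w} → w ≤ suc k → over w ℚᵘ.≤ toℚᵘ 1ℚ
  over≤1 w≤1+k = *≤* (subst₂ ℤ._≤_ (sym (ℤₚ.*-identityʳ _)) (sym (ℤₚ.*-identityˡ _)) (+≤+ w≤1+k))

sum-inv≤1 : ∀ {A : Set} (F : List A) (f w : A → ℕ) {K} → 0 < K →
  All (λ x → K ≤ f x * w x) F → sum (map w F) ≤ K → sumℚ (map (λ x → inv (f x)) F) ≤ℚ 1ℚ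
sum-inv≤1 F f w {suc k} _ bounds total = toℚᵘ-cancel-≤ (ℚᵘₚ.≤-respˡ-≃ (ℚᵘₚ.≃-sym sum≃)
  (ℚᵘₚ.≤-trans (sum-inv≤over k f w bounds) (over≤1 k total)))
  where
  sum≃ : toℚᵘ (sumℚ (map (λ x → inv (f x)) F)) ℚᵘ.≃ sumᵘ (map (λ x → toℚᵘ (inv (f x))) F)
  sum≃ = subst (λ l → toℚᵘ (sumℚ (map (λ x → inv (f x)) F)) ℚᵘ.≃ sumᵘ l) (sym (map-∘ F))
               (toℚᵘ-sumℚ (map (λ x → inv (f x)) F))

corollary5 : (p q r : ℕ) → 1 ≤ p → 1 ≤ q →
    (A : List (Subset (p + q))) → IsAntichain (InS p q r) A →
    (hgt : Subset (p + q) → ℕ) → (∀ x → InS p q r x → IsHeight (InS p q r) x (hgt x)) →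
    (N : ℕ → ℕ) → (∀ h → LevelSize (InS p q r) h (N h)) →
    sumℚ (map (λ x → inv (N (hgt x))) A) ≤ℚ 1ℚ
corollary5 p q r _ _ A A-antichain@(_ , A⊆S , _) hgt hgt-is-height N levels =
  sum-inv≤1 A (N ∘ hgt) (weight (centre p q)) (totalWeight-positive (centre p q)) level-bounds lym
  where
  open Sphere p q r
  lym : sum (map (weight (centre p q)) A) ≤ totalWeight (centre p q)
  lym = weighted-LYM (p + q) (centre p q) r A (IsAntichain⇒Antichain A-antichain)
          (All.tabulate λ {x} x∈A → S⇒ (A⊆S x x∈A))
  level-bounds : All (λ x → totalWeight (centre p q) ≤ N (hgt x) * weight (centre p q) x) A
  level-bounds = All.tabulate λ {x} x∈A →
    level-bound (A⊆S x x∈A) (hgt-is-height x (A⊆S x x∈A)) (levels (hgt x))
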